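{- For every integer $k\geq 1$ and every integer $t\geq 0$, the number of dominating $k$-sets of the cycle $C_{k+t}$ is \[ \gamma_k(C_{k+t})=\sum_{m=0}^{\lfloor t/2\rfloor+1}\binom{k-1}{t-m}\left(\binom{t-m+2}{m}+2\binom{t-m}{m-2}\right). \]
   Context: For a (multi)graph $G$, a set $D$ of vertices is dominating if every vertex not in $D$ is adjacent to some vertex of $D$; $\gamma_k(G)$ is the number of dominating sets of cardinality exactly $k$. $C_n$ is the cycle with $n$ vertices for $n\geq 3$; by convention $C_1=K_1$ and $C_2$ is the dicycle (two vertices joined by two parallel edges). Binomial coefficients $\binom{a}{b}$ are $0$ when $b<0$ or $b>a$. -}

module Defs where

open import Data.Nat using (ℕ; zero; suc; _+_; _*_; _≟_; _/_)
open import Data.Nat.Combinatorics using (_C_)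
open import Data.Integer using (ℤ; +_; -[1+_])
open import Data.Fin using (Fin; toℕ)
open import Data.Fin.Properties using (all?; any?)
open import Data.Fin.Subset using (Subset; _∈_; ∣_∣; inside; outside)
open import Data.Fin.Subset.Properties using (_∈?_)
open import Data.Vec using ([]; _∷_)
open import Data.List using (List; [_]; _++_; map; length; filter; upTo)
open import Data.Nat.ListAction using (sum)
open import Data.Product using (Σ; _×_; _,_)
open import Data.Sum using (_⊎_)
open import Relation.Binary.PropositionalEquality using (_≡_; _≢_)
open import Relation.Nullary using (Dec; ¬?)
open import Relation.Nullary.Decidable using (_×-dec_; _⊎-dec_)
import Data.Fin as F

-- For n = 1 this gives K_1 (no edges),
-- for n = 2 the two vertices are adjacent (the dicycle; edge multiplicity is
-- irrelevant for domination), for n ≥ 3 the usual cycle.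
CycleAdj : (n : ℕ) → Fin n → Fin n → Set
CycleAdj n i j =
  (i ≢ j) ×
  ((suc (toℕ i) ≡ toℕ j) ⊎ (suc (toℕ j) ≡ toℕ i)
   ⊎ ((toℕ i ≡ 0) × (suc (toℕ j) ≡ n))
   ⊎ ((toℕ j ≡ 0) × (suc (toℕ i) ≡ n)))

cycleAdj? : (n : ℕ) → (i j : Fin n) → Dec (CycleAdj n i j)
cycleAdj? n i j =
  ¬? (i F.≟ j) ×-dec
  ((suc (toℕ i) ≟ toℕ j) ⊎-dec (suc (toℕ j) ≟ toℕ i)
   ⊎-dec ((toℕ i ≟ 0) ×-dec (suc (toℕ j) ≟ n))
   ⊎-dec ((toℕ j ≟ 0) ×-dec (suc (toℕ i) ≟ n)))

Dominating : (n : ℕ) → Subset n → Set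
Dominating n D = ∀ v → (v ∈ D) ⊎ Σ (Fin n) (λ u → (u ∈ D) × CycleAdj n u v)

dominating? : (n : ℕ) → (D : Subset n) → Dec (Dominating n D)
dominating? n D = all? (λ v → (v ∈? D) ⊎-dec any? (λ u → (u ∈? D) ×-dec cycleAdj? n u v))

allSubsets : (n : ℕ) → List (Subset n)
allSubsets zero = [ [] ]
allSubsets (suc n) = map (inside ∷_) (allSubsets n) ++ map (outside ∷_) (allSubsets n)

γ : (k n : ℕ) → ℕ
γ k n = length (filter (λ D → (∣ D ∣ ≟ k) ×-dec dominating? n D) (allSubsets n))

binomℤ : ℤ → ℤ → ℕ
binomℤ a -[1+ _ ] = 0
binomℤ -[1+ _ ] (+ _) = 0
binomℤ (+ a) (+ b) = a C b

sumTo : ℕ → (ℕ → ℕ) → ℕ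
sumTo N f = sum (map f (upTo (suc N)))

-- A vertex set of C_n is dominating iff its indicator word has no three
-- cyclically consecutive zeros.  Cutting such a word before each of its ones
-- splits it into blocks 1, 10 and 100, so the number G(r, t) of dominating sets
-- with r + 1 elements and t non-elements satisfies
--   G(r + 1, t) = G(r, t) + G(r, t - 1) + G(r, t - 2);
-- a transfer-matrix count of words with prescribed first and last letters makes
-- this precise.  The right-hand side obeys the same recurrence in k, by Pascal's
-- rule applied to binom(k - 1, t - m) and to the bracket, and at k = 1 both
-- sides are 1, 2, 3, 0, 0, ...

module Submission where

open import Defs
open import Data.Bool as Bool using (Bool; true; false; T; _∧_; _∨_)
open import Data.Bool.Properties using (T-∧; T-∨; T-≡; ∨-zeroʳ; ∨-identityʳ)
open import Data.Fin as Fin using (Fin; toℕ; fromℕ<)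
open import Data.Fin.Properties using (toℕ<n; toℕ-fromℕ<)
open import Data.Fin.Subset using (Subset; _∈_; ∣_∣; inside; outside)
open import Data.Integer as ℤ using (ℤ; +_; -[1+_]; _-_; -_)
open import Data.Integer.Properties using ([+m]-[+n]≡m⊖n; ≤-⊖; ⊖-<)
open import Data.List using ([]; _∷_; _++_; map; length; filter; applyUpTo)
open import Data.List.Properties using (map-++; map-∘)
open import Data.Nat as ℕ
  using (ℕ; zero; suc; _+_; _*_; _∸_; _/_; _≤_; _<_; _≥_; _≤?_; _≟_; _≡ᵇ_; s≤s; z≤n)
open import Data.Nat.Combinatorics using (_C_; nCk+nC[k+1]≡[n+1]C[k+1]; k>n⇒nCk≡0)
open import Data.Nat.DivMod using (m≡m%n+[m/n]*n; m%n<n; m/n≤m)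
open import Data.Nat.ListAction using (sum)
open import Data.Nat.ListAction.Properties using (sum-++)
open import Data.Nat.Properties
open import Algebra.Properties.CommutativeSemigroup +-commutativeSemigroup
  using () renaming (interchange to +-interchange)
open import Data.Product using (Σ; _×_; _,_; proj₁; proj₂)
open import Data.Sum using (_⊎_; inj₁; inj₂)
open import Data.Vec using (Vec; []; _∷_; _∷ʳ_; lookup)
open import Data.Vec.Properties using ([]=⇒lookup; lookup⇒[]=)
open import Function using (_∘_; _⇔_; mk⇔; Equivalence)
open import Relation.Binary.PropositionalEquality
open import Relation.Nullary using (Dec; yes; no; does; contradiction)
open import Relation.Nullary.Decidable using (dec-true; dec-false)
open import Relation.Unary using (Decidable)
import Data.Integer.Tactic.RingSolver as ℤ-Solver
import Data.Nat.Tactic.RingSolver as ℕ-Solver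

open Equivalence using (to; from)

shift : (ℕ → ℕ) → ℕ → ℕ
shift f zero    = 0
shift f (suc t) = f t

-- For counts indexed by the number of zeros: append a block 1, 10 or 100.
addBlock : (ℕ → ℕ) → ℕ → ℕ
addBlock f t = f t + shift f t + shift (shift f) t

Recurrent : (ℕ → ℕ → ℕ) → Set
Recurrent F = ∀ r t → F (suc r) t ≡ addBlock (F r) t

shift-cong : ∀ {f g} → (∀ t → f t ≡ g t) → ∀ t → shift f t ≡ shift g t
shift-cong f≗g zero    = refl
shift-cong f≗g (suc t) = f≗g t

addBlock-cong : ∀ {f g} → (∀ t → f t ≡ g t) → ∀ t → addBlock f t ≡ addBlock g t
addBlock-cong f≗g t =
  cong₂ _+_ (cong₂ _+_ (f≗g t) (shift-cong f≗g t)) (shift-cong (shift-cong f≗g) t)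

shift-+ : ∀ f g t → shift (λ t → f t + g t) t ≡ shift f t + shift g t
shift-+ f g zero    = refl
shift-+ f g (suc t) = refl

addBlock-+ : ∀ f g t → addBlock (λ t → f t + g t) t ≡ addBlock f t + addBlock g t
addBlock-+ f g t = begin
  (f t + g t) + shift (λ t → f t + g t) t + shift (shift (λ t → f t + g t)) t
    ≡⟨ cong₂ (λ x y → (f t + g t) + x + y) (shift-+ f g t)
             (trans (shift-cong (shift-+ f g) t) (shift-+ (shift f) (shift g) t)) ⟩
  (f t + g t) + (shift f t + shift g t) + (shift (shift f) t + shift (shift g) t)
    ≡⟨ cong (_+ (shift (shift f) t + shift (shift g) t)) (+-interchange (f t) (g t) _ _) ⟩
  (f t + shift f t) + (g t + shift g t) + (shift (shift f) t + shift (shift g) t)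
    ≡⟨ +-interchange (f t + shift f t) _ _ _ ⟩
  addBlock f t + addBlock g t ∎
  where open ≡-Reasoning

recurrent-+ : ∀ {F G} → Recurrent F → Recurrent G → Recurrent (λ r t → F r t + G r t)
recurrent-+ {F} {G} F-rec G-rec r t =
  trans (cong₂ _+_ (F-rec r t) (G-rec r t)) (sym (addBlock-+ (F r) (G r) t))

recurrent-shift : ∀ {F} → Recurrent F → Recurrent (λ r → shift (F r))
recurrent-shift F-rec r zero    = refl
recurrent-shift F-rec r (suc t) = F-rec r t

recurrent-unique : ∀ {F G} → Recurrent F → Recurrent G → (∀ t → F 0 t ≡ G 0 t) →
                   ∀ r t → F r t ≡ G r t
recurrent-unique F-rec G-rec base zero    t = base t
recurrent-unique F-rec G-rec base (suc r) t =
  trans (F-rec r t)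
        (trans (addBlock-cong (recurrent-unique F-rec G-rec base r) t) (sym (G-rec r t)))

𝟙 : Bool → ℕ
𝟙 true  = 1
𝟙 false = 0

𝟙-∧ : ∀ x y → 𝟙 (x ∧ y) ≡ 𝟙 x * 𝟙 y
𝟙-∧ true  y = sym (+-identityʳ (𝟙 y))
𝟙-∧ false y = refl

does-⇔ : ∀ {P : Set} (P? : Dec P) {b} → P ⇔ T b → does P? ≡ b
does-⇔ P? {true}  P⇔T = dec-true P? (from P⇔T _)
does-⇔ P? {false} P⇔T = dec-false P? (to P⇔T)

length-filter≡sum : ∀ {A : Set} {P : A → Set} (P? : Decidable P) xs →
  length (filter P? xs) ≡ sum (map (𝟙 ∘ does ∘ P?) xs)
length-filter≡sum P? []       = refl
length-filter≡sum P? (x ∷ xs) with does (P? x)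
... | true  = cong suc (length-filter≡sum P? xs)
... | false = length-filter≡sum P? xs

sumWords : ∀ n → (Vec Bool n → ℕ) → ℕ
sumWords zero    f = f []
sumWords (suc n) f = sumWords n (f ∘ (true ∷_)) + sumWords n (f ∘ (false ∷_))

sumWords-cong : ∀ n {f g : Vec Bool n → ℕ} → (∀ w → f w ≡ g w) → sumWords n f ≡ sumWords n g
sumWords-cong zero    f≗g = f≗g []
sumWords-cong (suc n) f≗g =
  cong₂ _+_ (sumWords-cong n (f≗g ∘ (true ∷_))) (sumWords-cong n (f≗g ∘ (false ∷_)))

sumWords-*ˡ : ∀ n c (f : Vec Bool n → ℕ) → sumWords n (λ w → c * f w) ≡ c * sumWords n f
sumWords-*ˡ zero    c f = refl
sumWords-*ˡ (suc n) c f =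
  trans (cong₂ _+_ (sumWords-*ˡ n c _) (sumWords-*ˡ n c _)) (sym (*-distribˡ-+ c _ _))

sumWords-+ : ∀ n (f g : Vec Bool n → ℕ) →
  sumWords n (λ w → f w + g w) ≡ sumWords n f + sumWords n g
sumWords-+ zero    f g = refl
sumWords-+ (suc n) f g = begin
  sumWords n (λ w → f (true ∷ w) + g (true ∷ w)) + sumWords n (λ w → f (false ∷ w) + g (false ∷ w))
    ≡⟨ cong₂ _+_ (sumWords-+ n _ _) (sumWords-+ n _ _) ⟩
  (sumWords n (f ∘ (true ∷_)) + sumWords n (g ∘ (true ∷_)))
    + (sumWords n (f ∘ (false ∷_)) + sumWords n (g ∘ (false ∷_)))
    ≡⟨ +-interchange (sumWords n (f ∘ (true ∷_))) _ _ _ ⟩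
  sumWords (suc n) f + sumWords (suc n) g ∎
  where open ≡-Reasoning

sum-map-allSubsets : ∀ n (f : Subset n → ℕ) → sum (map f (allSubsets n)) ≡ sumWords n f
sum-map-allSubsets zero    f = +-identityʳ (f [])
sum-map-allSubsets (suc n) f = begin
  sum (map f (map (inside ∷_) xs ++ map (outside ∷_) xs))
    ≡⟨ cong sum (map-++ f (map (inside ∷_) xs) _) ⟩
  sum (map f (map (inside ∷_) xs) ++ map f (map (outside ∷_) xs))
    ≡⟨ sum-++ (map f (map (inside ∷_) xs)) _ ⟩
  sum (map f (map (inside ∷_) xs)) + sum (map f (map (outside ∷_) xs))
    ≡⟨ cong₂ (λ ys zs → sum ys + sum zs) (map-∘ xs) (map-∘ xs) ⟨
  sum (map (f ∘ (inside ∷_)) xs) + sum (map (f ∘ (outside ∷_)) xs)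
    ≡⟨ cong₂ _+_ (sum-map-allSubsets n _) (sum-map-allSubsets n _) ⟩
  sumWords (suc n) f ∎
  where
  open ≡-Reasoning
  xs = allSubsets n

lastOf : ∀ {n} → Bool → Vec Bool n → Bool
lastOf b []       = b
lastOf _ (c ∷ cs) = lastOf c cs

covered : ∀ {n} → Bool → Bool → Vec Bool n → Bool → Bool
covered a b []       e = a ∨ b ∨ e
covered a b (c ∷ cs) e = (a ∨ b ∨ c) ∧ covered b c cs e

-- The cyclic word x ∷ cs is unrolled to  lastOf x cs , x , cs , x :  its
-- windows of three consecutive letters are the closed neighbourhoods in C_n.
cyclicallyCovered : ∀ {n} → Vec Bool n → Bool
cyclicallyCovered []       = true
cyclicallyCovered (x ∷ cs) = covered (lastOf x cs) x cs x

at : ∀ {n} → Vec Bool n → ℕ → Bool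
at []       _       = false
at (x ∷ _)  zero    = x
at (_ ∷ xs) (suc i) = at xs i

window : ∀ {n} → Vec Bool n → ℕ → Bool
window xs i = at xs i ∨ at xs (suc i) ∨ at xs (suc (suc i))

covered⇔windows : ∀ {m} a b (cs : Vec Bool m) e →
  T (covered a b cs e) ⇔ (∀ i → i < suc m → T (window (a ∷ b ∷ (cs ∷ʳ e)) i))
covered⇔windows a b cs e = mk⇔ (⇒ a b cs e) (⇐ a b cs e)
  where
  ⇒ : ∀ {m} a b (cs : Vec Bool m) e → T (covered a b cs e) →
      ∀ i → i < suc m → T (window (a ∷ b ∷ (cs ∷ʳ e)) i)
  ⇒ a b []       e h zero    _           = h
  ⇒ a b []       e h (suc i) (s≤s ())
  ⇒ a b (c ∷ cs) e h zero    _           = proj₁ (to T-∧ h)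
  ⇒ a b (c ∷ cs) e h (suc i) (s≤s i<1+m) = ⇒ b c cs e (proj₂ (to T-∧ h)) i i<1+m
  ⇐ : ∀ {m} a b (cs : Vec Bool m) e →
      (∀ i → i < suc m → T (window (a ∷ b ∷ (cs ∷ʳ e)) i)) → T (covered a b cs e)
  ⇐ a b []       e h = h 0 (s≤s z≤n)
  ⇐ a b (c ∷ cs) e h = from T-∧ (h 0 (s≤s z≤n) , ⇐ b c cs e (λ i i<1+m → h (suc i) (s≤s i<1+m)))

predAt : ∀ {n} → Vec Bool n → ℕ → Bool
predAt {n} D zero    = at D (n ∸ 1)
predAt     D (suc i) = at D i

succAt : ∀ {n} → Vec Bool n → ℕ → Bool
succAt {n} D i with suc i ≟ n
... | yes _ = at D 0
... | no  _ = at D (suc i)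

closedNbhd : ∀ {n} → Vec Bool n → ℕ → Bool
closedNbhd D i = predAt D i ∨ at D i ∨ succAt D i

succAt-wrap : ∀ {n} (D : Vec Bool n) i → suc i ≡ n → succAt D i ≡ at D 0
succAt-wrap {n} D i 1+i≡n with suc i ≟ n
... | yes _     = refl
... | no  1+i≢n = contradiction 1+i≡n 1+i≢n

succAt-inner : ∀ {n} (D : Vec Bool n) i → suc i < n → succAt D i ≡ at D (suc i)
succAt-inner {n} D i 1+i<n with suc i ≟ n
... | yes 1+i≡n = contradiction 1+i≡n (<⇒≢ 1+i<n)
... | no  _     = refl

at-∷ʳ : ∀ {n} (D : Vec Bool n) y j → j < n → at (D ∷ʳ y) j ≡ at D j
at-∷ʳ (x ∷ D) y zero    _         = refl
at-∷ʳ (x ∷ D) y (suc j) (s≤s j<n) = at-∷ʳ D y j j<n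

at-∷ʳ-end : ∀ {n} (D : Vec Bool n) y → at (D ∷ʳ y) n ≡ y
at-∷ʳ-end []      y = refl
at-∷ʳ-end (x ∷ D) y = at-∷ʳ-end D y

at-lastOf : ∀ {m} x (cs : Vec Bool m) → lastOf x cs ≡ at (x ∷ cs) m
at-lastOf x []       = refl
at-lastOf x (c ∷ cs) = at-lastOf c cs

window≡closedNbhd : ∀ {m} x (cs : Vec Bool m) i → i < suc m →
  window (lastOf x cs ∷ ((x ∷ cs) ∷ʳ x)) i ≡ closedNbhd (x ∷ cs) i
window≡closedNbhd {m} x cs i i<n =
  cong₂ _∨_ (left i i<n) (cong₂ _∨_ (at-∷ʳ (x ∷ cs) x i i<n) (right i i<n))
  where
  D = x ∷ cs
  left : ∀ i → i < suc m → at (lastOf x cs ∷ (D ∷ʳ x)) i ≡ predAt D i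
  left zero    _   = at-lastOf x cs
  left (suc i) i<n = at-∷ʳ D x i (<⇒≤ i<n)
  right : ∀ i → i < suc m → at (D ∷ʳ x) (suc i) ≡ succAt D i
  right i i<n with suc i ≟ suc m
  ... | yes refl  = at-∷ʳ-end D x
  ... | no  1+i≢n = at-∷ʳ D x (suc i) (≤∧≢⇒< i<n 1+i≢n)

cyclicallyCovered⇔closedNbhds : ∀ {n} (D : Vec Bool n) →
  T (cyclicallyCovered D) ⇔ (∀ i → i < n → T (closedNbhd D i))
cyclicallyCovered⇔closedNbhds []       = mk⇔ (λ _ _ ()) _
cyclicallyCovered⇔closedNbhds (x ∷ cs) = mk⇔
  (λ h i i<n → subst T (window≡closedNbhd x cs i i<n) (to covered⇔ h i i<n))
  (λ h → from covered⇔ (λ i i<n → subst T (sym (window≡closedNbhd x cs i i<n)) (h i i<n)))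
  where covered⇔ = covered⇔windows (lastOf x cs) x cs x

DominatedBy : (n : ℕ) → Subset n → Fin n → Set
DominatedBy n D v = (v ∈ D) ⊎ Σ (Fin n) (λ u → (u ∈ D) × CycleAdj n u v)

at-toℕ : ∀ {n} (D : Vec Bool n) v → at D (toℕ v) ≡ lookup D v
at-toℕ (x ∷ D) Fin.zero    = refl
at-toℕ (x ∷ D) (Fin.suc v) = at-toℕ D v

∈⇔at : ∀ {n} (D : Subset n) v → v ∈ D ⇔ T (at D (toℕ v))
∈⇔at D v = mk⇔
  (λ v∈D → from T-≡ (trans (at-toℕ D v) ([]=⇒lookup v∈D)))
  (λ h → lookup⇒[]= v D (trans (sym (at-toℕ D v)) (to T-≡ h)))

at-bound : ∀ {n} (D : Vec Bool n) j → T (at D j) → j < n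
at-bound (x ∷ D) zero    _ = s≤s z≤n
at-bound (x ∷ D) (suc j) h = s≤s (at-bound D j h)

dominatedBy⇒closedNbhd : ∀ n (D : Subset n) v → DominatedBy n D v → T (closedNbhd D (toℕ v))
dominatedBy⇒closedNbhd n D v (inj₁ v∈D) =
  from (T-∨ {predAt D (toℕ v)}) (inj₂ (from (T-∨ {at D (toℕ v)}) (inj₁ (to (∈⇔at D v) v∈D))))
dominatedBy⇒closedNbhd n D v (inj₂ (u , u∈D , adj)) = fromAdj adj
  where
  pred : T (predAt D (toℕ v)) → T (closedNbhd D (toℕ v))
  pred h = from (T-∨ {predAt D (toℕ v)}) (inj₁ h)
  succ : T (succAt D (toℕ v)) → T (closedNbhd D (toℕ v))
  succ h = from (T-∨ {predAt D (toℕ v)}) (inj₂ (from (T-∨ {at D (toℕ v)}) (inj₂ h)))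
  Du : T (at D (toℕ u))
  Du = to (∈⇔at D u) u∈D
  fromAdj : CycleAdj n u v → T (closedNbhd D (toℕ v))
  fromAdj (_ , inj₁ 1+u≡v) = pred (subst (T ∘ predAt D) 1+u≡v Du)
  fromAdj (_ , inj₂ (inj₁ 1+v≡u)) =
    succ (subst T (sym (succAt-inner D (toℕ v) (subst (_< n) (sym 1+v≡u) (toℕ<n u))))
                  (subst (T ∘ at D) (sym 1+v≡u) Du))
  fromAdj (_ , inj₂ (inj₂ (inj₁ (u≡0 , 1+v≡n)))) =
    succ (subst T (sym (succAt-wrap D (toℕ v) 1+v≡n)) (subst (T ∘ at D) u≡0 Du))
  fromAdj (_ , inj₂ (inj₂ (inj₂ (v≡0 , 1+u≡n)))) =
    pred (subst (T ∘ predAt D) (sym v≡0) (subst (T ∘ at D) (cong (_∸ 1) 1+u≡n) Du))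

dominatedByNeighbour : ∀ {n} (D : Subset n) v j → T (at D j) →
  (∀ u → toℕ u ≡ j → u ≢ v → CycleAdj n u v) → DominatedBy n D v
dominatedByNeighbour {n} D v j h adj = viaVertex (fromℕ< j<n) (toℕ-fromℕ< j<n)
  where
  j<n = at-bound D j h
  viaVertex : ∀ u → toℕ u ≡ j → DominatedBy n D v
  viaVertex u u≡j with u∈D ← from (∈⇔at D u) (subst (T ∘ at D) (sym u≡j) h) | u Fin.≟ v
  ... | yes refl = inj₁ u∈D
  ... | no  u≢v  = inj₂ (u , u∈D , adj u u≡j u≢v)

closedNbhd⇒dominatedBy : ∀ n (D : Subset n) v → T (closedNbhd D (toℕ v)) → DominatedBy n D v
closedNbhd⇒dominatedBy (suc n) D v h with to (T-∨ {predAt D (toℕ v)}) h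
... | inj₁ h-pred = fromPred (toℕ v) refl h-pred
  where
  fromPred : ∀ i → toℕ v ≡ i → T (predAt D i) → DominatedBy (suc n) D v
  fromPred zero    v≡0   h = dominatedByNeighbour D v n h
    (λ _ u≡n u≢v → u≢v , inj₂ (inj₂ (inj₂ (v≡0 , cong suc u≡n))))
  fromPred (suc i) v≡1+i h = dominatedByNeighbour D v i h
    (λ _ u≡i u≢v → u≢v , inj₁ (trans (cong suc u≡i) (sym v≡1+i)))
... | inj₂ h' with to (T-∨ {at D (toℕ v)}) h'
...   | inj₁ h-self = inj₁ (from (∈⇔at D v) h-self)
...   | inj₂ h-succ = fromSucc h-succ
  where
  fromSucc : T (succAt D (toℕ v)) → DominatedBy (suc n) D v
  fromSucc h with suc (toℕ v) ≟ suc n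
  ... | yes 1+v≡n = dominatedByNeighbour D v 0 h
    (λ _ u≡0 u≢v → u≢v , inj₂ (inj₂ (inj₁ (u≡0 , 1+v≡n))))
  ... | no  _     = dominatedByNeighbour D v (suc (toℕ v)) h
    (λ _ u≡1+v u≢v → u≢v , inj₂ (inj₁ (sym u≡1+v)))

dominating⇔cyclicallyCovered : ∀ n (D : Subset n) → Dominating n D ⇔ T (cyclicallyCovered D)
dominating⇔cyclicallyCovered n D = mk⇔
  (λ dom → from (cyclicallyCovered⇔closedNbhds D) λ i i<n →
     subst (T ∘ closedNbhd D) (toℕ-fromℕ< i<n)
           (dominatedBy⇒closedNbhd n D (fromℕ< i<n) (dom (fromℕ< i<n))))
  (λ cov v → closedNbhd⇒dominatedBy n D v (to (cyclicallyCovered⇔closedNbhds D) cov (toℕ v) (toℕ<n v)))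

γ≡sumWords : ∀ k n → γ k n ≡ sumWords n (λ D → 𝟙 (∣ D ∣ ≡ᵇ k) * 𝟙 (cyclicallyCovered D))
γ≡sumWords k n = begin
  γ k n
    ≡⟨ length-filter≡sum _ (allSubsets n) ⟩
  sum (map (λ D → 𝟙 ((∣ D ∣ ≡ᵇ k) ∧ does (dominating? n D))) (allSubsets n))
    ≡⟨ sum-map-allSubsets n _ ⟩
  sumWords n (λ D → 𝟙 ((∣ D ∣ ≡ᵇ k) ∧ does (dominating? n D)))
    ≡⟨ sumWords-cong n (λ D → trans (𝟙-∧ (∣ D ∣ ≡ᵇ k) _)
         (cong (λ b → 𝟙 (∣ D ∣ ≡ᵇ k) * 𝟙 b)
               (does-⇔ (dominating? n D) (dominating⇔cyclicallyCovered n D)))) ⟩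
  sumWords n (λ D → 𝟙 (∣ D ∣ ≡ᵇ k) * 𝟙 (cyclicallyCovered D)) ∎
  where open ≡-Reasoning

-- coverings a b e ℓ r n counts the words cs of length n with r ones such that
-- a ∷ b ∷ cs ∷ʳ e has no three consecutive zeros and lastOf b cs ≡ ℓ.
coverings : Bool → Bool → Bool → Bool → ℕ → ℕ → ℕ
coverings a b e ℓ r       zero    = 𝟙 (a ∨ b ∨ e) * 𝟙 (0 ≡ᵇ r) * 𝟙 (does (b Bool.≟ ℓ))
coverings a b e ℓ zero    (suc n) = 𝟙 (a ∨ b) * coverings b false e ℓ zero n
coverings a b e ℓ (suc r) (suc n) = coverings b true e ℓ r n + 𝟙 (a ∨ b) * coverings b false e ℓ (suc r) n

coveringWeight : ∀ {n} → Bool → Bool → Bool → Bool → ℕ → Vec Bool n → ℕ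
coveringWeight a b e ℓ r cs =
  𝟙 (covered a b cs e) * 𝟙 (∣ cs ∣ ≡ᵇ r) * 𝟙 (does (lastOf b cs Bool.≟ ℓ))

𝟙-∧-* : ∀ x y p q → 𝟙 (x ∧ y) * p * q ≡ 𝟙 x * (𝟙 y * p * q)
𝟙-∧-* true  y p q = sym (+-identityʳ (𝟙 y * p * q))
𝟙-∧-* false y p q = refl

coveringWeight-∷ : ∀ {n} a b e ℓ r c (cs : Vec Bool n) →
  coveringWeight a b e ℓ (𝟙 c + r) (c ∷ cs) ≡ 𝟙 (a ∨ b ∨ c) * coveringWeight b c e ℓ r cs
coveringWeight-∷ a b e ℓ r true  cs = 𝟙-∧-* (a ∨ b ∨ true) _ _ _
coveringWeight-∷ a b e ℓ r false cs = 𝟙-∧-* (a ∨ b ∨ false) _ _ _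

sumWords-coveringWeight : ∀ n a b e ℓ r → sumWords n (coveringWeight a b e ℓ r) ≡ coverings a b e ℓ r n
sumWords-coveringWeight zero    a b e ℓ r = refl
sumWords-coveringWeight (suc n) a b e ℓ r = byOnes r
  where
  extend : ∀ c r → sumWords n (λ cs → coveringWeight a b e ℓ (𝟙 c + r) (c ∷ cs))
                   ≡ 𝟙 (a ∨ b ∨ c) * coverings b c e ℓ r n
  extend c r = begin
    sumWords n (λ cs → coveringWeight a b e ℓ (𝟙 c + r) (c ∷ cs))
      ≡⟨ sumWords-cong n (coveringWeight-∷ a b e ℓ r c) ⟩
    sumWords n (λ cs → 𝟙 (a ∨ b ∨ c) * coveringWeight b c e ℓ r cs)
      ≡⟨ sumWords-*ˡ n (𝟙 (a ∨ b ∨ c)) _ ⟩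
    𝟙 (a ∨ b ∨ c) * sumWords n (coveringWeight b c e ℓ r)
      ≡⟨ cong (𝟙 (a ∨ b ∨ c) *_) (sumWords-coveringWeight n b c e ℓ r) ⟩
    𝟙 (a ∨ b ∨ c) * coverings b c e ℓ r n ∎
    where open ≡-Reasoning
  extend-one : ∀ r → sumWords n (λ cs → coveringWeight a b e ℓ (suc r) (true ∷ cs))
                     ≡ coverings b true e ℓ r n
  extend-one r = trans (extend true r)
    (trans (cong (λ x → 𝟙 x * _) (trans (cong (a ∨_) (∨-zeroʳ b)) (∨-zeroʳ a))) (+-identityʳ _))
  extend-zero : ∀ r → sumWords n (λ cs → coveringWeight a b e ℓ r (false ∷ cs))
                      ≡ 𝟙 (a ∨ b) * coverings b false e ℓ r n
  extend-zero r = trans (extend false r) (cong (λ x → 𝟙 x * _) (cong (a ∨_) (∨-identityʳ b)))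
  noOnesLeft : sumWords n (λ cs → coveringWeight a b e ℓ zero (true ∷ cs)) ≡ 0
  noOnesLeft = trans (sumWords-cong n (λ cs → cong (_* 𝟙 (does (lastOf true cs Bool.≟ ℓ)))
                                                 (*-zeroʳ (𝟙 ((a ∨ b ∨ true) ∧ covered b true cs e)))))
                     (sumWords-*ˡ n 0 (λ _ → 0))
  byOnes : ∀ r → sumWords (suc n) (coveringWeight a b e ℓ r) ≡ coverings a b e ℓ r (suc n)
  byOnes zero    = cong₂ _+_ noOnesLeft (extend-zero zero)
  byOnes (suc r) = cong₂ _+_ (extend-one r) (extend-zero (suc r))

expand-Bool : ∀ (f : Bool → ℕ) b →
  f b ≡ f true * 𝟙 (does (b Bool.≟ true)) + f false * 𝟙 (does (b Bool.≟ false))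
expand-Bool f true  =
  sym (trans (cong₂ _+_ (*-identityʳ (f true)) (*-zeroʳ (f false))) (+-identityʳ (f true)))
expand-Bool f false = sym (cong₂ _+_ (*-zeroʳ (f true)) (*-identityʳ (f false)))

sumWords-closedUp : ∀ m x r →
  sumWords m (λ cs → 𝟙 (covered (lastOf x cs) x cs x) * 𝟙 (∣ cs ∣ ≡ᵇ r))
  ≡ coverings true x x true r m + coverings false x x false r m
sumWords-closedUp m x r = begin
  sumWords m (λ cs → 𝟙 (covered (lastOf x cs) x cs x) * 𝟙 (∣ cs ∣ ≡ᵇ r))
    ≡⟨ sumWords-cong m (λ cs →
         expand-Bool (λ ℓ → 𝟙 (covered ℓ x cs x) * 𝟙 (∣ cs ∣ ≡ᵇ r)) (lastOf x cs)) ⟩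
  sumWords m (λ cs → coveringWeight true x x true r cs + coveringWeight false x x false r cs)
    ≡⟨ sumWords-+ m _ _ ⟩
  sumWords m (coveringWeight true x x true r) + sumWords m (coveringWeight false x x false r)
    ≡⟨ cong₂ _+_ (sumWords-coveringWeight m true x x true r)
                 (sumWords-coveringWeight m false x x false r) ⟩
  coverings true x x true r m + coverings false x x false r m ∎
  where open ≡-Reasoning

γ≡coverings : ∀ r m → γ (suc r) (suc m) ≡
  (coverings true true true true r m + coverings false true true false r m) +
  (coverings true false false true (suc r) m + coverings false false false false (suc r) m)
γ≡coverings r m = begin
  γ (suc r) (suc m)
    ≡⟨ γ≡sumWords (suc r) (suc m) ⟩
  sumWords (suc m) (λ D → 𝟙 (∣ D ∣ ≡ᵇ suc r) * 𝟙 (cyclicallyCovered D))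
    ≡⟨ sumWords-cong (suc m) (λ D → *-comm (𝟙 (∣ D ∣ ≡ᵇ suc r)) (𝟙 (cyclicallyCovered D))) ⟩
  sumWords (suc m) (λ D → 𝟙 (cyclicallyCovered D) * 𝟙 (∣ D ∣ ≡ᵇ suc r))
    ≡⟨ cong₂ _+_ (sumWords-closedUp m true r) (sumWords-closedUp m false (suc r)) ⟩
  _ ∎
  where open ≡-Reasoning

coverings-tooManyOnes : ∀ a b e ℓ r n → n < r → coverings a b e ℓ r n ≡ 0
coverings-tooManyOnes a b e ℓ (suc r) zero    _         =
  cong (_* 𝟙 (does (b Bool.≟ ℓ))) (*-zeroʳ (𝟙 (a ∨ b ∨ e)))
coverings-tooManyOnes a b e ℓ (suc r) (suc n) (s≤s n<r) = cong₂ _+_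
  (coverings-tooManyOnes b true e ℓ r n n<r)
  (trans (cong (𝟙 (a ∨ b) *_) (coverings-tooManyOnes b false e ℓ (suc r) n (≤-trans n<r (n≤1+n r))))
         (*-zeroʳ (𝟙 (a ∨ b))))

coverings-afterOne : ∀ a e ℓ r n → coverings a true e ℓ r n ≡ coverings true true e ℓ r n
coverings-afterOne true  e ℓ r       n       = refl
coverings-afterOne false e ℓ r       zero    = refl
coverings-afterOne false e ℓ zero    (suc n) = refl
coverings-afterOne false e ℓ (suc r) (suc n) = refl

coverings-noOnes : ∀ ℓ n → coverings false false false ℓ 0 n ≡ 0
coverings-noOnes ℓ zero    = refl
coverings-noOnes ℓ (suc n) = refl

-- Words with r ones and s zeros continuing a word that ends in a one.
afterOne : Bool → Bool → ℕ → ℕ → ℕ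
afterOne e ℓ r s = coverings true true e ℓ r (r + s)

coverings-afterTwoZeros : ∀ e ℓ r s →
  coverings false false e ℓ (suc r) (r + s) ≡ shift (afterOne e ℓ r) s
coverings-afterTwoZeros e ℓ r zero    =
  trans (cong (coverings false false e ℓ (suc r)) (+-identityʳ r))
        (coverings-tooManyOnes false false e ℓ (suc r) r (n<1+n r))
coverings-afterTwoZeros e ℓ r (suc s) rewrite +-suc r s =
  trans (+-identityʳ _) (coverings-afterOne false e ℓ r (r + s))

coverings-afterZero : ∀ e ℓ r s → coverings true false e ℓ (suc r) (r + s)
                                  ≡ shift (afterOne e ℓ r) s + shift (shift (afterOne e ℓ r)) s
coverings-afterZero e ℓ r zero    =
  trans (cong (coverings true false e ℓ (suc r)) (+-identityʳ r))
        (coverings-tooManyOnes true false e ℓ (suc r) r (n<1+n r))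
coverings-afterZero e ℓ r (suc s) rewrite +-suc r s = cong₂ _+_
  (coverings-afterOne false e ℓ r (r + s))
  (trans (+-identityʳ _) (coverings-afterTwoZeros e ℓ r s))

afterOne-recurrent : ∀ e ℓ → Recurrent (afterOne e ℓ)
afterOne-recurrent e ℓ r s = begin
  afterOne e ℓ r s + 1 * coverings true false e ℓ (suc r) (r + s)
    ≡⟨ cong (_+_ (afterOne e ℓ r s)) (trans (+-identityʳ _) (coverings-afterZero e ℓ r s)) ⟩
  afterOne e ℓ r s + (shift (afterOne e ℓ r) s + shift (shift (afterOne e ℓ r)) s)
    ≡⟨ +-assoc (afterOne e ℓ r s) _ _ ⟨
  addBlock (afterOne e ℓ r) s ∎
  where open ≡-Reasoning

sumBelow : ℕ → (ℕ → ℕ) → ℕ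
sumBelow zero    f = 0
sumBelow (suc n) f = f 0 + sumBelow n (f ∘ suc)

sum-map-applyUpTo : ∀ {A : Set} n (g : ℕ → A) (f : A → ℕ) →
  sum (map f (applyUpTo g n)) ≡ sumBelow n (f ∘ g)
sum-map-applyUpTo zero    g f = refl
sum-map-applyUpTo (suc n) g f = cong (_+_ (f (g 0))) (sum-map-applyUpTo n (g ∘ suc) f)

sumTo≡sumBelow : ∀ N f → sumTo N f ≡ sumBelow (suc N) f
sumTo≡sumBelow N f = sum-map-applyUpTo (suc N) (λ m → m) f

sumBelow-cong : ∀ n {f g} → (∀ m → f m ≡ g m) → sumBelow n f ≡ sumBelow n g
sumBelow-cong zero    f≗g = refl
sumBelow-cong (suc n) f≗g = cong₂ _+_ (f≗g 0) (sumBelow-cong n (f≗g ∘ suc))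

sumBelow-+ : ∀ n f g → sumBelow n (λ m → f m + g m) ≡ sumBelow n f + sumBelow n g
sumBelow-+ zero    f g = refl
sumBelow-+ (suc n) f g = trans (cong (_+_ (f 0 + g 0)) (sumBelow-+ n (f ∘ suc) (g ∘ suc)))
                               (+-interchange (f 0) (g 0) _ _)

sumBelow-zero : ∀ n f → (∀ m → f m ≡ 0) → sumBelow n f ≡ 0
sumBelow-zero zero    f f≗0 = refl
sumBelow-zero (suc n) f f≗0 = cong₂ _+_ (f≗0 0) (sumBelow-zero n (f ∘ suc) (f≗0 ∘ suc))

sumBelow-++ : ∀ n j f → sumBelow (n + j) f ≡ sumBelow n f + sumBelow j (λ m → f (n + m))
sumBelow-++ zero    j f = refl
sumBelow-++ (suc n) j f =
  trans (cong (_+_ (f 0)) (sumBelow-++ n j (f ∘ suc))) (sym (+-assoc (f 0) _ _))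

sumBelow-truncate : ∀ n B f → n ≤ B → (∀ m → n ≤ m → f m ≡ 0) → sumBelow B f ≡ sumBelow n f
sumBelow-truncate n B f n≤B tail≡0 with j , refl ← m≤n⇒∃[o]m+o≡n n≤B = begin
  sumBelow (n + j) f
    ≡⟨ sumBelow-++ n j f ⟩
  sumBelow n f + sumBelow j (λ m → f (n + m))
    ≡⟨ cong (_+_ (sumBelow n f)) (sumBelow-zero j _ (λ m → tail≡0 (n + m) (m≤m+n n m))) ⟩
  sumBelow n f + 0
    ≡⟨ +-identityʳ _ ⟩
  sumBelow n f ∎
  where open ≡-Reasoning

binomℤ-pascal : ∀ a b → binomℤ (+ suc a) b ≡ binomℤ (+ a) b + binomℤ (+ a) (b - + 1)
binomℤ-pascal a -[1+ j ]    = refl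
binomℤ-pascal a (+ zero)    = refl
binomℤ-pascal a (+ (suc j)) = trans (sym (nCk+nC[k+1]≡[n+1]C[k+1] a j)) (+-comm (a C j) (a C suc j))

bracket : ℤ → ℤ → ℕ
bracket x j = binomℤ (x ℤ.+ + 2) j + 2 * binomℤ x (j - + 2)

summand : ℕ → ℤ → ℕ → ℕ
summand k τ m = binomℤ (+ k - + 1) (τ - + m) * bracket (τ - + m) (+ m)

formula : ℕ → ℕ → ℕ
formula k t = sumTo (t / 2 + 1) (summand k (+ t))

bracket-pascal : ∀ n j → bracket (+ suc n) j ≡ bracket (+ n) j + bracket (+ n) (j - + 1)
bracket-pascal n j = begin
  binomℤ (+ suc (n + 2)) j + 2 * binomℤ (+ suc n) (j - + 2)
    ≡⟨ cong₂ (λ a b → a + 2 * b) (binomℤ-pascal (n + 2) j) (binomℤ-pascal n (j - + 2)) ⟩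
  (binomℤ (+ (n + 2)) j + binomℤ (+ (n + 2)) (j - + 1))
    + 2 * (binomℤ (+ n) (j - + 2) + binomℤ (+ n) ((j - + 2) - + 1))
    ≡⟨ cong (λ i → (binomℤ (+ (n + 2)) j + binomℤ (+ (n + 2)) (j - + 1))
                    + 2 * (binomℤ (+ n) (j - + 2) + binomℤ (+ n) i))
            (swap-subtractions j) ⟩
  (binomℤ (+ (n + 2)) j + binomℤ (+ (n + 2)) (j - + 1))
    + 2 * (binomℤ (+ n) (j - + 2) + binomℤ (+ n) ((j - + 1) - + 2))
    ≡⟨ regroup (binomℤ (+ (n + 2)) j) _ (binomℤ (+ n) (j - + 2)) (binomℤ (+ n) ((j - + 1) - + 2)) ⟩
  bracket (+ n) j + bracket (+ n) (j - + 1) ∎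
  where
  open ≡-Reasoning
  regroup : ∀ a b c d → (a + b) + 2 * (c + d) ≡ (a + 2 * c) + (b + 2 * d)
  regroup = ℕ-Solver.solve-∀
  swap-subtractions : ∀ j → (j - + 2) - + 1 ≡ (j - + 1) - + 2
  swap-subtractions = ℤ-Solver.solve-∀

-- For x ≤ 0 the common factor vanishes; otherwise this is bracket-pascal.
weighted-bracket-pascal : ∀ k x j →
  binomℤ (+ k) (x - + 1) * bracket x j
  ≡ binomℤ (+ k) (x - + 1) * bracket (x - + 1) j + binomℤ (+ k) (x - + 1) * bracket (x - + 1) (j - + 1)
weighted-bracket-pascal k -[1+ n ]    j = refl
weighted-bracket-pascal k (+ zero)    j = refl
weighted-bracket-pascal k (+ (suc n)) j =
  trans (cong (binomℤ (+ k) (+ n) *_) (bracket-pascal n j)) (*-distribˡ-+ (binomℤ (+ k) (+ n)) _ _)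

summand-recurrence : ∀ k τ m → summand (suc (suc k)) τ m
  ≡ summand (suc k) τ m + summand (suc k) (τ - + 1) m + shift (summand (suc k) (τ - + 2)) m
summand-recurrence k τ m = begin
  binomℤ (+ suc k) x * bracket x (+ m)
    ≡⟨ cong (_* bracket x (+ m)) (binomℤ-pascal k x) ⟩
  (binomℤ (+ k) x + binomℤ (+ k) (x - + 1)) * bracket x (+ m)
    ≡⟨ *-distribʳ-+ (bracket x (+ m)) (binomℤ (+ k) x) _ ⟩
  summand (suc k) τ m + binomℤ (+ k) (x - + 1) * bracket x (+ m)
    ≡⟨ cong (_+_ (summand (suc k) τ m)) (weighted-bracket-pascal k x (+ m)) ⟩
  summand (suc k) τ m + (weighted (x - + 1) (+ m) + weighted (x - + 1) (+ m - + 1))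
    ≡⟨ +-assoc (summand (suc k) τ m) _ _ ⟨
  summand (suc k) τ m + weighted (x - + 1) (+ m) + weighted (x - + 1) (+ m - + 1)
    ≡⟨ cong₂ (λ a b → summand (suc k) τ m + a + b)
             (cong (λ y → weighted y (+ m)) (sub-swap τ (+ m))) (lastTerm m) ⟩
  summand (suc k) τ m + summand (suc k) (τ - + 1) m + shift (summand (suc k) (τ - + 2)) m ∎
  where
  open ≡-Reasoning
  x = τ - + m
  weighted : ℤ → ℤ → ℕ
  weighted y j = binomℤ (+ k) y * bracket y j
  sub-swap : ∀ τ μ → (τ - μ) - + 1 ≡ (τ - + 1) - μ
  sub-swap = ℤ-Solver.solve-∀
  sub-shift : ∀ τ μ → (τ - (+ 1 ℤ.+ μ)) - + 1 ≡ (τ - + 2) - μ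
  sub-shift = ℤ-Solver.solve-∀
  lastTerm : ∀ m → weighted ((τ - + m) - + 1) (+ m - + 1) ≡ shift (summand (suc k) (τ - + 2)) m
  lastTerm zero    = *-zeroʳ (binomℤ (+ k) ((τ - + 0) - + 1))
  lastTerm (suc m) = cong (λ y → weighted y (+ m)) (sub-shift τ (+ m))

sumBelow-summand-recurrence : ∀ k τ B → sumBelow (suc B) (summand (suc (suc k)) τ)
  ≡ sumBelow (suc B) (summand (suc k) τ) + sumBelow (suc B) (summand (suc k) (τ - + 1))
    + sumBelow B (summand (suc k) (τ - + 2))
sumBelow-summand-recurrence k τ B = begin
  sumBelow (suc B) (summand (suc (suc k)) τ)
    ≡⟨ sumBelow-cong (suc B) (summand-recurrence k τ) ⟩
  sumBelow (suc B) (λ m → f m + g m + shift h m)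
    ≡⟨ sumBelow-+ (suc B) (λ m → f m + g m) (shift h) ⟩
  sumBelow (suc B) (λ m → f m + g m) + sumBelow B h
    ≡⟨ cong (_+ sumBelow B h) (sumBelow-+ (suc B) f g) ⟩
  sumBelow (suc B) f + sumBelow (suc B) g + sumBelow B h ∎
  where
  open ≡-Reasoning
  f g h : ℕ → ℕ
  f = summand (suc k) τ
  g = summand (suc k) (τ - + 1)
  h = summand (suc k) (τ - + 2)

t/2+2≤m⇒t+3≤m+m : ∀ t m → suc (t / 2 + 1) ≤ m → t + 3 ≤ m + m
t/2+2≤m⇒t+3≤m+m t m h = begin
  t + 3
    ≤⟨ +-monoˡ-≤ 3 t≤1+2q ⟩
  suc (t / 2 * 2) + 3
    ≡⟨ regroup (t / 2) ⟩
  suc (t / 2 + 1) * 2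
    ≤⟨ *-monoˡ-≤ 2 h ⟩
  m * 2
    ≡⟨ trans (*-comm m 2) (cong (_+_ m) (+-identityʳ m)) ⟩
  m + m ∎
  where
  open ≤-Reasoning
  regroup : ∀ q → suc (q * 2) + 3 ≡ suc (q + 1) * 2
  regroup = ℕ-Solver.solve-∀
  t≤1+2q : t ≤ suc (t / 2 * 2)
  t≤1+2q = begin
    t                   ≡⟨ m≡m%n+[m/n]*n t 2 ⟩
    t ℕ.% 2 + t / 2 * 2 ≤⟨ +-monoˡ-≤ (t / 2 * 2) (ℕ.s≤s⁻¹ (m%n<n t 2)) ⟩
    suc (t / 2 * 2)     ∎

+[m+d]-+m≡+d : ∀ m d → + (m + d) - + m ≡ + d
+[m+d]-+m≡+d m d =
  trans ([+m]-[+n]≡m⊖n (m + d) m) (trans (≤-⊖ (m≤m+n m d)) (cong +_ (m+n∸m≡n m d)))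

+t-+[1+t+d]≡-[1+d] : ∀ t d → + t - + (suc t + d) ≡ -[1+ d ]
+t-+[1+t+d]≡-[1+d] t d = trans ([+m]-[+n]≡m⊖n t (suc t + d))
  (trans (⊖-< (s≤s (m≤m+n t d)))
         (cong (λ n → - (+ n)) (trans (cong (ℕ._∸ t) (sym (+-suc t d))) (m+n∸m≡n t (suc d)))))

summand≡0-fromNonnegative : ∀ k t m →
  (∀ d → m + d ≡ t → binomℤ (+ k - + 1) (+ d) * bracket (+ d) (+ m) ≡ 0) → summand k (+ t) m ≡ 0
summand≡0-fromNonnegative k t m h with m ≤? t
... | yes m≤t with d , refl ← m≤n⇒∃[o]m+o≡n m≤t rewrite +[m+d]-+m≡+d m d = h d refl
... | no  m≰t with d , refl ← m≤n⇒∃[o]m+o≡n (≰⇒> m≰t) rewrite +t-+[1+t+d]≡-[1+d] t d = refl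

bracket-vanishes : ∀ d m → 3 + d ≤ m → bracket (+ d) (+ m) ≡ 0
bracket-vanishes d (suc (suc m)) (s≤s (s≤s d<m)) = cong₂ (λ a b → a + 2 * b)
  (k>n⇒nCk≡0 (≤-trans (≤-reflexive (cong suc (+-comm d 2))) (s≤s (s≤s d<m))))
  (k>n⇒nCk≡0 d<m)

summand-vanishes : ∀ k t m → t + 3 ≤ m + m → summand k (+ t) m ≡ 0
summand-vanishes k t m h = summand≡0-fromNonnegative k t m vanishes
  where
  vanishes : ∀ d → m + d ≡ t → binomℤ (+ k - + 1) (+ d) * bracket (+ d) (+ m) ≡ 0
  vanishes d refl = trans (cong (binomℤ (+ k - + 1) (+ d) *_) (bracket-vanishes d m 3+d≤m))
                          (*-zeroʳ (binomℤ (+ k - + 1) (+ d)))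
    where
    3+d≤m : 3 + d ≤ m
    3+d≤m = +-cancelˡ-≤ m (3 + d) m
      (≤-trans (≤-reflexive (trans (cong (_+_ m) (+-comm 3 d)) (sym (+-assoc m d 3)))) h)

sumBelow-summand≡formula : ∀ k t B → 2 + t ≤ B → sumBelow B (summand k (+ t)) ≡ formula k t
sumBelow-summand≡formula k t B 2+t≤B = begin
  sumBelow B (summand k (+ t))
    ≡⟨ sumBelow-truncate (suc (t / 2 + 1)) B _ (≤-trans bound 2+t≤B)
         (λ m h → summand-vanishes k t m (t/2+2≤m⇒t+3≤m+m t m h)) ⟩
  sumBelow (suc (t / 2 + 1)) (summand k (+ t))
    ≡⟨ sumTo≡sumBelow (t / 2 + 1) (summand k (+ t)) ⟨
  formula k t ∎
  where
  open ≡-Reasoning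
  bound : suc (t / 2 + 1) ≤ 2 + t
  bound = s≤s (≤-trans (+-monoˡ-≤ 1 (m/n≤m t 2)) (≤-reflexive (+-comm t 1)))

sumBelow-summand-negative : ∀ k n B → sumBelow B (summand k -[1+ n ]) ≡ 0
sumBelow-summand-negative k n B = sumBelow-zero B _ λ where
  zero    → refl
  (suc m) → refl

formula-recurrent : Recurrent (formula ∘ suc)
formula-recurrent k t = begin
  formula (suc (suc k)) t
    ≡⟨ sumBelow-summand≡formula (suc (suc k)) t (3 + t) (n≤1+n (2 + t)) ⟨
  sumBelow (3 + t) (summand (suc (suc k)) (+ t))
    ≡⟨ sumBelow-summand-recurrence k (+ t) (2 + t) ⟩
  sumBelow (3 + t) (summand (suc k) (+ t)) + sumBelow (3 + t) (summand (suc k) (+ t - + 1))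
    + sumBelow (2 + t) (summand (suc k) (+ t - + 2))
    ≡⟨ cong₂ _+_ (cong₂ _+_ (sumBelow-summand≡formula (suc k) t (3 + t) (n≤1+n (2 + t)))
                            (oneShifted t))
                 (twoShifted t) ⟩
  addBlock (formula (suc k)) t ∎
  where
  open ≡-Reasoning
  oneShifted : ∀ t → sumBelow (3 + t) (summand (suc k) (+ t - + 1)) ≡ shift (formula (suc k)) t
  oneShifted zero    = sumBelow-summand-negative (suc k) 0 3
  oneShifted (suc t) = sumBelow-summand≡formula (suc k) t (4 + t) (m≤n+m (2 + t) 2)
  twoShifted : ∀ t → sumBelow (2 + t) (summand (suc k) (+ t - + 2)) ≡ shift (shift (formula (suc k))) t
  twoShifted zero          = sumBelow-summand-negative (suc k) 1 2
  twoShifted (suc zero)    = sumBelow-summand-negative (suc k) 0 3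
  twoShifted (suc (suc t)) = sumBelow-summand≡formula (suc k) t (4 + t) (m≤n+m (2 + t) 2)

formula-1-vanishes : ∀ t → formula 1 (3 + t) ≡ 0
formula-1-vanishes t = trans (sumTo≡sumBelow ((3 + t) / 2 + 1) (summand 1 (+ (3 + t))))
  (sumBelow-zero (suc ((3 + t) / 2 + 1)) _ (λ m → summand≡0-fromNonnegative 1 (3 + t) m (vanishes m)))
  where
  vanishes : ∀ m d → m + d ≡ 3 + t → binomℤ (+ 1 - + 1) (+ d) * bracket (+ d) (+ m) ≡ 0
  vanishes m                   (suc d) _ = refl
  vanishes (suc (suc (suc m))) zero    _ = refl
  vanishes zero                zero    ()
  vanishes (suc zero)          zero    ()
  vanishes (suc (suc zero))    zero    ()

-- The four terms correspond to (first letter, last letter) = (1,1), (1,0), (0,1), (0,0).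
dominatingCount : ℕ → ℕ → ℕ
dominatingCount r t =
  (afterOne true true r t + afterOne true false r t)
  + ((shift (afterOne false true r) t + shift (shift (afterOne false true r)) t)
     + shift (afterOne false false r) t)

γ≡dominatingCount : ∀ r t → γ (suc r) (suc r + t) ≡ dominatingCount r t
γ≡dominatingCount r t = trans (γ≡coverings r (r + t))
  (cong₂ _+_ (cong (_+_ (afterOne true true r t)) (coverings-afterOne false true false r (r + t)))
             (cong₂ _+_ (coverings-afterZero false true r t) (coverings-afterTwoZeros false false r t)))

dominatingCount-recurrent : Recurrent dominatingCount
dominatingCount-recurrent =
  recurrent-+ (recurrent-+ (afterOne-recurrent true true) (afterOne-recurrent true false))
              (recurrent-+ (recurrent-+ (recurrent-shift (afterOne-recurrent false true))
                                        (recurrent-shift (recurrent-shift (afterOne-recurrent false true))))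
                           (recurrent-shift (afterOne-recurrent false false)))

dominatingCount-initial : ∀ t → dominatingCount 0 t ≡ formula 1 t
dominatingCount-initial 0 = refl
dominatingCount-initial 1 = refl
dominatingCount-initial 2 = refl
dominatingCount-initial (suc (suc (suc t))) = trans (tooManyZeros t) (sym (formula-1-vanishes t))
  where
  tooManyZeros : ∀ t → dominatingCount 0 (3 + t) ≡ 0
  tooManyZeros zero    = refl
  tooManyZeros (suc t) rewrite coverings-noOnes true t = refl

mainTheorem9 : (k t : ℕ) → k ≥ 1 →
    γ k (k + t) ≡
      sumTo (t / 2 + 1) (λ m →
        binomℤ ((+ k) - (+ 1)) ((+ t) - (+ m))
          * (binomℤ ((+ t) - (+ m) ℤ.+ (+ 2)) (+ m) + 2 * binomℤ ((+ t) - (+ m)) ((+ m) - (+ 2))))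
mainTheorem9 (suc r) t _ = trans (γ≡dominatingCount r t)
  (recurrent-unique dominatingCount-recurrent formula-recurrent dominatingCount-initial r t)
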